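{- Let $p$ be a prime, $q \ge 2$ an integer coprime to $p$, and $n > 1$ an integer. Let $n' = n + 1 - p^{\lfloor \log_p(n+1)\rfloor}$ (so $n - n' + 1$ is a power of $p$). Let $R = F_p[x_1,\ldots,x_n]/(x_1^2-x_1,\ldots,x_n^2-x_n)$ and let $\chi_q\in R$ be the function with $\chi_q(x) = 1$ if $q$ divides $|x| = x_1+\cdots+x_n$ and $0$ otherwise. If $f \in \langle \chi_q\rangle$ is a nonzero symmetric function, then $$\deg(f) \ge (n - n')\left(1 - \frac{1}{p^{\ell}}\right), \qquad \ell = \lfloor \log_p(q-1)\rfloor.$$
   Context: Elements of $R$ are identified with their multilinear representatives and with functions $\{0,1\}^n\to F_p$; degree is the degree of the multilinear representative. $\langle \chi_q\rangle$ is the ideal of $R$ generated by $\chi_q$; a function is symmetric if invariant under all permutations of the variables. -}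

module Defs where

open import Data.Nat using (ℕ; zero; suc; _+_; _*_; _<_; _≤_)
open import Data.Integer as ℤ using (ℤ; +_)
open import Data.Integer.Divisibility using () renaming (_∣_ to _∣ℤ_)
open import Data.Bool using (Bool; true; false; if_then_else_)
open import Data.Vec using (Vec; []; _∷_; lookup; tabulate)
open import Data.List using (List; []; _∷_; map; _++_; foldr)
open import Data.Fin using (Fin)
open import Data.Fin.Permutation using (Permutation′; _⟨$⟩ʳ_)
open import Data.Nat.Divisibility using (_∣_)
open import Data.Product using (Σ; _×_; ∃)
open import Relation.Nullary using (¬_; Dec; yes; no)
open import Data.Nat.DivMod using (_%_)

-- Elements of F_p are represented by natural numbers, compared modulo p.
_≡[mod_]_ : ℕ → ℕ → ℕ → Set
a ≡[mod p ] b = (+ p) ∣ℤ ((+ a) ℤ.- (+ b))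

Point : ℕ → Set
Point n = Vec Bool n

-- Functions {0,1}^n → F_p (i.e. elements of R), with ℕ representatives.
Fn : ℕ → Set
Fn n = Point n → ℕ

allPoints : (n : ℕ) → List (Point n)
allPoints zero = [] ∷ []
allPoints (suc n) = map (false ∷_) (allPoints n) ++ map (true ∷_) (allPoints n)

sumL : List ℕ → ℕ
sumL = foldr _+_ 0

weight : ∀ {n} → Point n → ℕ
weight [] = 0
weight (false ∷ x) = weight x
weight (true ∷ x) = suc (weight x)

-- Value of the monomial x_S = ∏_{i ∈ S} x_i at the point x (S given by its indicator vector).
monomial : ∀ {n} → Point n → Point n → ℕ
monomial [] [] = 1
monomial (false ∷ S) (_ ∷ x) = monomial S x
monomial (true ∷ S) (false ∷ x) = 0
monomial (true ∷ S) (true ∷ x) = monomial S x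

evalML : ∀ {n} → (Point n → ℕ) → Point n → ℕ
evalML {n} c x = sumL (map (λ S → c S * monomial S x) (allPoints n))

-- deg f ≤ d : f (as a function {0,1}^n → F_p) is represented by a multilinear
-- polynomial over F_p all of whose monomials with nonzero coefficient have size ≤ d.
-- (The multilinear representative is unique, so this is deg of the representative ≤ d.)
DegLe : ∀ {n} → ℕ → Fn n → ℕ → Set
DegLe {n} p f d =
  Σ (Point n → ℕ) λ c →
    (∀ S → d < weight S → c S ≡[mod p ] 0) ×
    (∀ x → f x ≡[mod p ] evalML c x)

chi : ∀ {n} → ℕ → Fn n
chi q x with Data.Nat.Divisibility._∣?_ q (weight x)
... | yes _ = 1
... | no _ = 0

InIdealChi : ∀ {n} → ℕ → ℕ → Fn n → Set
InIdealChi {n} p q f = Σ (Fn n) λ g → ∀ x → f x ≡[mod p ] (g x * chi q x)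

NonZeroFn : ∀ {n} → ℕ → Fn n → Set
NonZeroFn {n} p f = ∃ λ (x : Point n) → ¬ (f x ≡[mod p ] 0)

permute : ∀ {n} → Permutation′ n → Point n → Point n
permute σ x = tabulate (λ i → lookup x (σ ⟨$⟩ʳ i))

Symmetric : ∀ {n} → ℕ → Fn n → Set
Symmetric {n} p f = ∀ (σ : Permutation′ n) (x : Point n) → f (permute σ x) ≡[mod p ] f x

-- Let F(w) be the value (mod p) of the symmetric f at the points of weight w.  Since deg f ≤ d,
-- every mixed difference of f in more than d coordinates vanishes, which for symmetric f says
-- Δᵗ F(j) ≡ 0 for t > d and j + t ≤ n, where Δ = E − 1 and E is the shift w ↦ w + 1.  Modulo p,
-- Δ^(p^e (p^c − 1)) = (E^(p^e) − 1)^(p^c − 1) = Σᵢ ±C(p^c − 1, i) E^(i p^e), and no C(p^c − 1, i)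
-- is divisible by p.  As f ∈ ⟨χ_q⟩, F vanishes off the multiples of q; as q is prime to p and
-- p^c ≤ q, the progression j, j + p^e, …, j + (p^c − 1) p^e contains at most one of them.  Running
-- such a progression inside [0, n] through a weight w₀ with F(w₀) ≢ 0 gives a non-vanishing
-- difference of order p^e (p^c − 1), so d ≥ p^e (p^c − 1); the theorem is the case
-- c = min(ℓ, k), e = k − c.
module Submission where

open import Defs
open import Data.Nat using (ℕ; suc; _+_; _*_; _∸_; _^_; _≤_; _<_)
open import Data.Nat.Primality using (Prime)
open import Data.Nat.Coprimality using (Coprime)

open import Data.Bool using (true; false)
open import Data.Empty using (⊥; ⊥-elim)
open import Data.Fin using (zero; suc)
open import Data.Fin.Permutation using (lift₀; transpose)
open import Data.Integer as ℤ using (ℤ; +_; 0ℤ; 1ℤ; -1ℤ)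
  renaming (_+_ to _+ᶻ_; _-_ to _-ᶻ_; _*_ to _*ᶻ_; -_ to -ᶻ_; _^_ to _^ᶻ_)
open import Data.Integer.Divisibility.Signed as ℤ∣ using (_∣_; divides)
import Data.Integer.Properties as ℤ
open import Data.Integer.Tactic.RingSolver using (solve-∀)
open import Data.List as L using (map)
open import Data.List.Properties using (map-++; map-∘)
open import Data.Nat using (zero; z≤n; s≤s; NonZero; ≢-nonZero⁻¹; >-nonZero)
open import Data.Nat.Combinatorics using (_C_; nCn≡1; nC1≡n; k>n⇒nCk≡0; nCk+nC[k+1]≡[n+1]C[k+1])
open import Data.Nat.Coprimality using (coprime-divisor)
open import Data.Nat.Divisibility as ℕ∣ using () renaming (_∣_ to _∣ℕ_)
open import Data.Nat.DivMod using (_/_; _%_; m≡m%n+[m/n]*n; m/n*n≤m; m%n<n)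
open import Data.Nat.ListAction.Properties using (sum-++)
open import Data.Nat.Primality using (euclidsLemma; prime⇒nonZero; prime⇒irreducible; ¬prime[1])
import Data.Nat.Properties as ℕ
open import Data.Nat.Tactic.RingSolver using () renaming (solve-∀ to ℕ-solve-∀)
open import Data.Product using (Σ; _×_; _,_)
open import Data.Sum using (_⊎_; inj₁; inj₂; [_,_]′)
open import Data.Vec using ([]; _∷_; _++_)
open import Data.Vec.Properties using (tabulate∘lookup)
open import Function using (_∘_; flip; case_of_)
open import Relation.Binary.Bundles using (Setoid)
open import Relation.Binary.Definitions using (tri<; tri≈; tri>)
open import Relation.Binary.PropositionalEquality
open import Relation.Nullary using (¬_; yes; no; contradiction)
open import Relation.Nullary.Decidable using (decidable-stable)

-- Wrapped in a record so that both sides of a congruence can be inferred.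
module Congruence (m : ℕ) where

  infix 4 _≈_
  record _≈_ (a b : ℤ) : Set where
    constructor mod≈
    field m∣a-b : + m ∣ a -ᶻ b

  private
    m∣-resp : ∀ {a b} → a ≡ b → + m ∣ a → + m ∣ b
    m∣-resp refl m∣a = m∣a

  ≈-reflexive : ∀ {a b} → a ≡ b → a ≈ b
  ≈-reflexive {a} refl = mod≈ (m∣-resp (sym (ℤ.+-inverseʳ a)) (divides 0ℤ refl))

  ≈-refl : ∀ {a} → a ≈ a
  ≈-refl = ≈-reflexive refl

  ≈-sym : ∀ {a b} → a ≈ b → b ≈ a
  ≈-sym {a} {b} (mod≈ m∣a-b) = mod≈ (m∣-resp (negate a b) (ℤ∣.∣m⇒∣-m m∣a-b))
    where
    negate : ∀ a b → -ᶻ (a -ᶻ b) ≡ b -ᶻ a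
    negate = solve-∀

  ≈-trans : ∀ {a b c} → a ≈ b → b ≈ c → a ≈ c
  ≈-trans {a} {b} {c} (mod≈ m∣a-b) (mod≈ m∣b-c) =
    mod≈ (m∣-resp (telescope a b c) (ℤ∣.∣m∣n⇒∣m+n m∣a-b m∣b-c))
    where
    telescope : ∀ a b c → (a -ᶻ b) +ᶻ (b -ᶻ c) ≡ a -ᶻ c
    telescope = solve-∀

  ≈-setoid : Setoid _ _
  ≈-setoid = record
    { Carrier = ℤ ; _≈_ = _≈_
    ; isEquivalence = record { refl = ≈-refl ; sym = ≈-sym ; trans = ≈-trans } }

  +-cong : ∀ {a b c d} → a ≈ b → c ≈ d → a +ᶻ c ≈ b +ᶻ d
  +-cong {a} {b} {c} {d} (mod≈ m∣a-b) (mod≈ m∣c-d) =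
    mod≈ (m∣-resp (regroup a b c d) (ℤ∣.∣m∣n⇒∣m+n m∣a-b m∣c-d))
    where
    regroup : ∀ a b c d → (a -ᶻ b) +ᶻ (c -ᶻ d) ≡ (a +ᶻ c) -ᶻ (b +ᶻ d)
    regroup = solve-∀

  -‿cong₂ : ∀ {a b c d} → a ≈ b → c ≈ d → a -ᶻ c ≈ b -ᶻ d
  -‿cong₂ {a} {b} {c} {d} (mod≈ m∣a-b) (mod≈ m∣c-d) =
    mod≈ (m∣-resp (regroup a b c d) (ℤ∣.∣m∣n⇒∣m-n m∣a-b m∣c-d))
    where
    regroup : ∀ a b c d → (a -ᶻ b) -ᶻ (c -ᶻ d) ≡ (a -ᶻ c) -ᶻ (b -ᶻ d)
    regroup = solve-∀

  *-congˡ : ∀ c {a b} → a ≈ b → c *ᶻ a ≈ c *ᶻ b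
  *-congˡ c {a} {b} (mod≈ m∣a-b) = mod≈ (m∣-resp (distrib c a b) (ℤ∣.∣n⇒∣m*n c m∣a-b))
    where
    distrib : ∀ c a b → c *ᶻ (a -ᶻ b) ≡ c *ᶻ a -ᶻ c *ᶻ b
    distrib = solve-∀

  *-congʳ : ∀ c {a b} → a ≈ b → a *ᶻ c ≈ b *ᶻ c
  *-congʳ c {a} {b} a≈b =
    ≈-trans (≈-reflexive (ℤ.*-comm a c)) (≈-trans (*-congˡ c a≈b) (≈-reflexive (ℤ.*-comm c b)))

  ≈0-*ˡ : ∀ c {a} → a ≈ 0ℤ → c *ᶻ a ≈ 0ℤ
  ≈0-*ˡ c a≈0 = ≈-trans (*-congˡ c a≈0) (≈-reflexive (ℤ.*-zeroʳ c))

  ≈0-*ʳ : ∀ c {a} → a ≈ 0ℤ → a *ᶻ c ≈ 0ℤ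
  ≈0-*ʳ c {a} a≈0 = ≈-trans (≈-reflexive (ℤ.*-comm a c)) (≈0-*ˡ c a≈0)

  ≈0⇒∣ᵤ : ∀ {a} → a ≈ 0ℤ → m ∣ℕ ℤ.∣ a ∣
  ≈0⇒∣ᵤ {a} (mod≈ m∣a-0) = ℤ∣.∣⇒∣ᵤ (m∣-resp (ℤ.+-identityʳ a) m∣a-0)

  ∣ᵤ⇒≈0 : ∀ {a} → m ∣ℕ ℤ.∣ a ∣ → a ≈ 0ℤ
  ∣ᵤ⇒≈0 {a} m∣∣a∣ = mod≈ (m∣-resp (sym (ℤ.+-identityʳ a)) (ℤ∣.∣ᵤ⇒∣ m∣∣a∣))

  fromℕ : ∀ {a b} → a ≡[mod m ] b → + a ≈ + b
  fromℕ a≡b = mod≈ (ℤ∣.∣ᵤ⇒∣ a≡b)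

  toℕ : ∀ {a b} → + a ≈ + b → a ≡[mod m ] b
  toℕ (mod≈ m∣a-b) = ℤ∣.∣⇒∣ᵤ m∣a-b

∑< : ℕ → (ℕ → ℤ) → ℤ
∑< zero    g = 0ℤ
∑< (suc M) g = g 0 +ᶻ ∑< M (g ∘ suc)

∑<-cong : ∀ M {g h : ℕ → ℤ} → (∀ i → g i ≡ h i) → ∑< M g ≡ ∑< M h
∑<-cong zero    g≡h = refl
∑<-cong (suc M) g≡h = cong₂ _+ᶻ_ (g≡h 0) (∑<-cong M (g≡h ∘ suc))

∑<-snoc : ∀ M (g : ℕ → ℤ) → ∑< (suc M) g ≡ ∑< M g +ᶻ g M
∑<-snoc zero    g = trans (ℤ.+-identityʳ (g 0)) (sym (ℤ.+-identityˡ (g 0)))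
∑<-snoc (suc M) g = trans (cong (g 0 +ᶻ_) (∑<-snoc M (g ∘ suc))) (sym (ℤ.+-assoc (g 0) _ _))

∑<-shift : ∀ M (g : ℕ → ℤ) → g (suc M) ≡ 0ℤ → ∑< (suc M) (g ∘ suc) ≡ ∑< (suc M) g -ᶻ g 0
∑<-shift M g g[1+M]≡0 = begin
  ∑< (suc M) (g ∘ suc)              ≡⟨ ∑<-snoc M (g ∘ suc) ⟩
  ∑< M (g ∘ suc) +ᶻ g (suc M)       ≡⟨ cong (∑< M (g ∘ suc) +ᶻ_) g[1+M]≡0 ⟩
  ∑< M (g ∘ suc) +ᶻ 0ℤ              ≡⟨ cancel (g 0) (∑< M (g ∘ suc)) ⟩
  g 0 +ᶻ ∑< M (g ∘ suc) -ᶻ g 0      ∎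
  where
  open ≡-Reasoning
  cancel : ∀ a x → x +ᶻ 0ℤ ≡ a +ᶻ x -ᶻ a
  cancel = solve-∀

∑<-distrib-- : ∀ M (g h : ℕ → ℤ) → ∑< M (λ i → g i -ᶻ h i) ≡ ∑< M g -ᶻ ∑< M h
∑<-distrib-- zero    g h = refl
∑<-distrib-- (suc M) g h =
  trans (cong (g 0 -ᶻ h 0 +ᶻ_) (∑<-distrib-- M (g ∘ suc) (h ∘ suc))) (regroup (g 0) (h 0) _ _)
  where
  regroup : ∀ a b x y → (a -ᶻ b) +ᶻ (x -ᶻ y) ≡ (a +ᶻ x) -ᶻ (b +ᶻ y)
  regroup = solve-∀

module _ {m : ℕ} where
  open Congruence m

  ∑<-≈0 : ∀ M (g : ℕ → ℤ) → (∀ i → i < M → g i ≈ 0ℤ) → ∑< M g ≈ 0ℤ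
  ∑<-≈0 zero    g _   = ≈-refl
  ∑<-≈0 (suc M) g g≈0 =
    +-cong (g≈0 0 (s≤s z≤n)) (∑<-≈0 M (g ∘ suc) (λ i i<M → g≈0 (suc i) (s≤s i<M)))

  ∑<-single : ∀ {M a} (g : ℕ → ℤ) → a < M → (∀ i → i < M → i ≢ a → g i ≈ 0ℤ) →
              ∑< M g ≈ g a
  ∑<-single {suc M} {zero} g _ g≈0 =
    ≈-trans (+-cong (≈-refl {g 0}) (∑<-≈0 M (g ∘ suc) (λ i i<M → g≈0 (suc i) (s≤s i<M) (λ ()))))
            (≈-reflexive (ℤ.+-identityʳ (g 0)))
  ∑<-single {suc M} {suc a} g (s≤s a<M) g≈0 =
    ≈-trans (+-cong (g≈0 0 (s≤s z≤n) (λ ()))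
                    (∑<-single (g ∘ suc) a<M
                      (λ i i<M i≢a → g≈0 (suc i) (s≤s i<M) (i≢a ∘ ℕ.suc-injective))))
            (≈-reflexive (ℤ.+-identityˡ (g (suc a))))

-1^[n+n]≡1 : ∀ n → -1ℤ ^ᶻ (n + n) ≡ 1ℤ
-1^[n+n]≡1 zero    = refl
-1^[n+n]≡1 (suc n) rewrite ℕ.+-suc n n | -1^[n+n]≡1 n = refl

-1^n≡-1⊎2∣n : ∀ n → -1ℤ ^ᶻ n ≡ -1ℤ ⊎ (-1ℤ ^ᶻ n ≡ 1ℤ × 2 ∣ℕ n)
-1^n≡-1⊎2∣n zero          = inj₂ (refl , ℕ∣.divides 0 refl)
-1^n≡-1⊎2∣n (suc zero)    = inj₁ refl
-1^n≡-1⊎2∣n (suc (suc n)) with -1^n≡-1⊎2∣n n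
... | inj₁ odd          = inj₁ (cong (λ x → -1ℤ *ᶻ (-1ℤ *ᶻ x)) odd)
... | inj₂ (even , 2∣n) =
  inj₂ (cong (λ x → -1ℤ *ᶻ (-1ℤ *ᶻ x)) even , ℕ∣.∣m∣n⇒∣m+n (ℕ∣.∣-refl {2}) 2∣n)

[1+k]*nC[1+k]≡n*[n∸1]Ck : ∀ n k → suc k * (n C suc k) ≡ n * ((n ∸ 1) C k)
[1+k]*nC[1+k]≡n*[n∸1]Ck zero          k       = ℕ.*-zeroʳ (suc k)
[1+k]*nC[1+k]≡n*[n∸1]Ck (suc zero)    zero    = refl
[1+k]*nC[1+k]≡n*[n∸1]Ck (suc zero)    (suc k) = ℕ.*-zeroʳ (suc (suc k))
[1+k]*nC[1+k]≡n*[n∸1]Ck (suc (suc r)) zero    =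
  trans (ℕ.*-identityˡ _) (trans (nC1≡n (suc (suc r))) (sym (ℕ.*-identityʳ _)))
[1+k]*nC[1+k]≡n*[n∸1]Ck (suc (suc r)) (suc i) = begin
  suc (suc i) * (suc (suc r) C suc (suc i))
    ≡⟨ cong (suc (suc i) *_) (sym (nCk+nC[k+1]≡[n+1]C[k+1] (suc r) (suc i))) ⟩
  suc (suc i) * (suc r C suc i + suc r C suc (suc i))
    ≡⟨ split (suc i) (suc r C suc i) (suc r C suc (suc i)) ⟩
  suc i * (suc r C suc i) + suc r C suc i + suc (suc i) * (suc r C suc (suc i))
    ≡⟨ cong₂ (λ a b → a + suc r C suc i + b) ([1+k]*nC[1+k]≡n*[n∸1]Ck (suc r) i)
                                             ([1+k]*nC[1+k]≡n*[n∸1]Ck (suc r) (suc i)) ⟩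
  suc r * (r C i) + suc r C suc i + suc r * (r C suc i)
    ≡⟨ cong (λ x → suc r * (r C i) + x + suc r * (r C suc i)) (sym (nCk+nC[k+1]≡[n+1]C[k+1] r i)) ⟩
  suc r * (r C i) + (r C i + r C suc i) + suc r * (r C suc i)
    ≡⟨ merge (suc r) (r C i) (r C suc i) ⟩
  suc (suc r) * (r C i + r C suc i)
    ≡⟨ cong (suc (suc r) *_) (nCk+nC[k+1]≡[n+1]C[k+1] r i) ⟩
  suc (suc r) * (suc r C suc i) ∎
  where
  open ≡-Reasoning
  split : ∀ j a b → suc j * (a + b) ≡ j * a + a + suc j * b
  split = ℕ-solve-∀
  merge : ∀ m a b → m * a + (a + b) + m * b ≡ suc m * (a + b)
  merge = ℕ-solve-∀

module _ {p : ℕ} (prime-p : Prime p) where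

  private instance
    p≢0 : NonZero p
    p≢0 = prime⇒nonZero prime-p

  suc[p^c∸1]≡p^c : ∀ c → suc (p ^ c ∸ 1) ≡ p ^ c
  suc[p^c∸1]≡p^c c = trans (ℕ.+-comm 1 (p ^ c ∸ 1)) (ℕ.m∸n+n≡m (ℕ.m^n>0 p c))

  p^c∣m*n∧p∤n⇒p^c∣m : ∀ c m n → p ^ c ∣ℕ m * n → ¬ p ∣ℕ n → p ^ c ∣ℕ m
  p^c∣m*n∧p∤n⇒p^c∣m zero    m n _ _ = ℕ∣.1∣ m
  p^c∣m*n∧p∤n⇒p^c∣m (suc c) m n p^[1+c]∣m*n p∤n
    with euclidsLemma m n prime-p (ℕ∣.∣-trans (ℕ∣.m∣m*n (p ^ c)) p^[1+c]∣m*n)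
  ... | inj₂ p∣n = contradiction p∣n p∤n
  ... | inj₁ (ℕ∣.divides m′ refl) =
    ℕ∣.∣-trans (ℕ∣.*-monoʳ-∣ p (p^c∣m*n∧p∤n⇒p^c∣m c m′ n p^c∣m′*n p∤n))
               (ℕ∣.∣-reflexive (ℕ.*-comm p m′))
    where
    reassoc : ∀ a b c → a * b * c ≡ b * (a * c)
    reassoc = ℕ-solve-∀
    p^c∣m′*n : p ^ c ∣ℕ m′ * n
    p^c∣m′*n = ℕ∣.*-cancelˡ-∣ p (subst (p * p ^ c ∣ℕ_) (reassoc m′ p n) p^[1+c]∣m*n)

  p∣p^cCk : ∀ c k → 0 < k → k < p ^ c → p ∣ℕ p ^ c C k
  p∣p^cCk c (suc k) _ 1+k<p^c = decidable-stable (p ℕ∣.∣? p ^ c C suc k) λ p∤C →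
    ℕ.<⇒≱ 1+k<p^c (ℕ∣.∣⇒≤ (p^c∣m*n∧p∤n⇒p^c∣m c (suc k) (p ^ c C suc k) p^c∣[1+k]*C p∤C))
    where
    p^c∣[1+k]*C : p ^ c ∣ℕ suc k * (p ^ c C suc k)
    p^c∣[1+k]*C = ℕ∣.divides ((p ^ c ∸ 1) C k)
      (trans ([1+k]*nC[1+k]≡n*[n∸1]Ck (p ^ c) k) (ℕ.*-comm (p ^ c) ((p ^ c ∸ 1) C k)))

  p∤[p^c∸1]Ck : ∀ c k → k < p ^ c → ¬ p ∣ℕ (p ^ c ∸ 1) C k
  p∤[p^c∸1]Ck c zero    _       p∣1 = ¬prime[1] (subst Prime (ℕ∣.∣1⇒≡1 p∣1) prime-p)
  p∤[p^c∸1]Ck c (suc k) 1+k<p^c p∣C =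
    p∤[p^c∸1]Ck c k (ℕ.<-trans (ℕ.n<1+n k) 1+k<p^c)
      (ℕ∣.∣m+n∣m⇒∣n (subst (p ∣ℕ_) pascal p∣p^cC[1+k]) p∣C)
    where
    M : ℕ
    M = p ^ c ∸ 1
    pascal : p ^ c C suc k ≡ M C suc k + M C k
    pascal = trans (cong (_C suc k) (sym (suc[p^c∸1]≡p^c c)))
                   (trans (sym (nCk+nC[k+1]≡[n+1]C[k+1] M k)) (ℕ.+-comm (M C k) (M C suc k)))
    p∣p^cC[1+k] : p ∣ℕ p ^ c C suc k
    p∣p^cC[1+k] = p∣p^cCk c (suc k) (s≤s z≤n) 1+k<p^c

Δ : ℕ → (ℕ → ℤ) → ℕ → ℤ
Δ s H w = H (w + s) -ᶻ H w

Δ^ : ℕ → ℕ → (ℕ → ℤ) → ℕ → ℤ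
Δ^ s zero    H = H
Δ^ s (suc r) H = Δ s (Δ^ s r H)

Δ^-+ : ∀ s a b H w → Δ^ s (a + b) H w ≡ Δ^ s a (Δ^ s b H) w
Δ^-+ s zero    b H w = refl
Δ^-+ s (suc a) b H w = cong₂ _-ᶻ_ (Δ^-+ s a b H (w + s)) (Δ^-+ s a b H w)

Δ^-suc : ∀ s t (G : ℕ → ℤ) w → Δ^ s t (G ∘ suc) w ≡ Δ^ s t G (suc w)
Δ^-suc s zero    G w = refl
Δ^-suc s (suc t) G w = cong₂ _-ᶻ_ (Δ^-suc s t G (w + s)) (Δ^-suc s t G w)

signedBinomial : ℕ → ℕ → ℤ
signedBinomial r i = -1ℤ ^ᶻ (r + i) *ᶻ + (r C i)

signedBinomial-pascal : ∀ r i →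
  signedBinomial (suc r) (suc i) ≡ signedBinomial r i -ᶻ signedBinomial r (suc i)
signedBinomial-pascal r i
  rewrite ℕ.+-suc r i
        | sym (nCk+nC[k+1]≡[n+1]C[k+1] r i)
        | ℤ.pos-+ (r C i) (r C suc i)
        = expand-sign (-1ℤ ^ᶻ (r + i)) (+ (r C i)) (+ (r C suc i))
  where
  expand-sign : ∀ x a b → -1ℤ *ᶻ (-1ℤ *ᶻ x) *ᶻ (a +ᶻ b) ≡ x *ᶻ a -ᶻ (-1ℤ *ᶻ x) *ᶻ b
  expand-sign = solve-∀

Δ^-expansion : ∀ s r H w → Δ^ s r H w ≡ ∑< (suc r) (λ i → signedBinomial r i *ᶻ H (w + i * s))
Δ^-expansion s zero    H w rewrite ℕ.+-identityʳ w = unit-coefficient (H w)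
  where
  unit-coefficient : ∀ h → h ≡ 1ℤ *ᶻ 1ℤ *ᶻ h +ᶻ 0ℤ
  unit-coefficient = solve-∀
Δ^-expansion s (suc r) H w = begin
  Δ^ s r H (w + s) -ᶻ Δ^ s r H w
    ≡⟨ cong₂ _-ᶻ_ (Δ^-expansion s r H (w + s)) (Δ^-expansion s r H w) ⟩
  ∑< (suc r) A -ᶻ ∑< (suc r) B
    ≡⟨ regroup (∑< (suc r) A) (∑< (suc r) B) (B 0) ⟩
  -ᶻ B 0 +ᶻ (∑< (suc r) A -ᶻ (∑< (suc r) B -ᶻ B 0))
    ≡⟨ cong₂ (λ x y → x +ᶻ (∑< (suc r) A -ᶻ y)) first-term (sym (∑<-shift r B B-vanishes)) ⟩
  leading +ᶻ (∑< (suc r) A -ᶻ ∑< (suc r) (B ∘ suc))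
    ≡⟨ cong (leading +ᶻ_) (sym (∑<-distrib-- (suc r) A (B ∘ suc))) ⟩
  leading +ᶻ ∑< (suc r) (λ i → A i -ᶻ B (suc i))
    ≡⟨ cong (leading +ᶻ_) (∑<-cong (suc r) pascal-term) ⟩
  signedBinomial (suc r) 0 *ᶻ H (w + 0) +ᶻ
    ∑< (suc r) (λ i → signedBinomial (suc r) (suc i) *ᶻ H (w + suc i * s)) ∎
  where
  open ≡-Reasoning
  leading : ℤ
  leading = signedBinomial (suc r) 0 *ᶻ H (w + 0)
  A B : ℕ → ℤ
  A i = signedBinomial r i *ᶻ H (w + s + i * s)
  B i = signedBinomial r i *ᶻ H (w + i * s)
  regroup : ∀ a b c → a -ᶻ b ≡ -ᶻ c +ᶻ (a -ᶻ (b -ᶻ c))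
  regroup = solve-∀
  first-term : -ᶻ B 0 ≡ leading
  first-term = negate (-1ℤ ^ᶻ (r + 0)) (H (w + 0))
    where
    negate : ∀ x h → -ᶻ (x *ᶻ 1ℤ *ᶻ h) ≡ -1ℤ *ᶻ x *ᶻ 1ℤ *ᶻ h
    negate = solve-∀
  B-vanishes : B (suc r) ≡ 0ℤ
  B-vanishes rewrite k>n⇒nCk≡0 (ℕ.n<1+n r) | ℤ.*-zeroʳ (-1ℤ ^ᶻ (r + suc r)) = refl
  pascal-term : ∀ i → A i -ᶻ B (suc i) ≡ signedBinomial (suc r) (suc i) *ᶻ H (w + suc i * s)
  pascal-term i rewrite signedBinomial-pascal r i | ℕ.+-assoc w s (i * s) =
    distrib (signedBinomial r i) (signedBinomial r (suc i)) (H (w + (s + i * s)))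
    where
    distrib : ∀ a b h → a *ᶻ h -ᶻ b *ᶻ h ≡ (a -ᶻ b) *ᶻ h
    distrib = solve-∀

module _ {m : ℕ} where
  open Congruence m

  Δ^-cong : ∀ s r {H H′ : ℕ → ℤ} → (∀ v → H v ≈ H′ v) → ∀ w → Δ^ s r H w ≈ Δ^ s r H′ w
  Δ^-cong s zero    H≈H′ w = H≈H′ w
  Δ^-cong s (suc r) H≈H′ w = -‿cong₂ (Δ^-cong s r H≈H′ (w + s)) (Δ^-cong s r H≈H′ w)

module _ {p : ℕ} (prime-p : Prime p) where
  open Congruence p
  open import Relation.Binary.Reasoning.Setoid ≈-setoid

  -- (−1)^p ≡ −1 also for p = 2, where 1 ≡ −1.
  -1^p≈-1 : -1ℤ ^ᶻ p ≈ -1ℤ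
  -1^p≈-1 with -1^n≡-1⊎2∣n p
  ... | inj₁ odd = ≈-reflexive odd
  ... | inj₂ (even , 2∣p) with prime⇒irreducible prime-p 2∣p
  ...   | inj₂ refl = ≈-trans (≈-reflexive even) (mod≈ ℤ∣.∣-refl)

  -- (E^s − 1)^p ≡ E^(ps) − 1: the binomial coefficients C(p, i), 0 < i < p, vanish mod p.
  Δ^p≈Δ[p*s] : ∀ s H w → Δ^ s p H w ≈ Δ (p * s) H w
  Δ^p≈Δ[p*s] s H w = begin
    Δ^ s p H w                                   ≡⟨ Δ^-expansion s p H w ⟩
    ∑< (suc p) g                                 ≡⟨ ∑<-snoc p g ⟩
    ∑< p g +ᶻ g p                                ≈⟨ +-cong (∑<-single g 0<p inner-terms≈0) ≈-refl ⟩
    g 0 +ᶻ g p                                   ≡⟨ outer-terms ⟩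
    -1ℤ ^ᶻ p *ᶻ H w +ᶻ H (w + p * s)             ≈⟨ +-cong (*-congʳ (H w) -1^p≈-1) ≈-refl ⟩
    -1ℤ *ᶻ H w +ᶻ H (w + p * s)                  ≡⟨ rearrange (H w) (H (w + p * s)) ⟩
    Δ (p * s) H w                                ∎
    where
    g : ℕ → ℤ
    g i = signedBinomial p i *ᶻ H (w + i * s)
    0<p : 0 < p
    0<p = ℕ.n≢0⇒n>0 (≢-nonZero⁻¹ p {{prime⇒nonZero prime-p}})
    inner-terms≈0 : ∀ i → i < p → i ≢ 0 → g i ≈ 0ℤ
    inner-terms≈0 i i<p i≢0 = ≈0-*ʳ (H (w + i * s)) (≈0-*ˡ (-1ℤ ^ᶻ (p + i)) (∣ᵤ⇒≈0 p∣pCi))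
      where
      p∣pCi : p ∣ℕ p C i
      p∣pCi = subst (λ N → p ∣ℕ N C i) (ℕ.*-identityʳ p)
                (p∣p^cCk prime-p 1 i (ℕ.n≢0⇒n>0 i≢0) (subst (i <_) (sym (ℕ.*-identityʳ p)) i<p))
    outer-terms : g 0 +ᶻ g p ≡ -1ℤ ^ᶻ p *ᶻ H w +ᶻ H (w + p * s)
    outer-terms = cong₂ _+ᶻ_
      (trans (cong₂ (λ e v → -1ℤ ^ᶻ e *ᶻ 1ℤ *ᶻ H v) (ℕ.+-identityʳ p) (ℕ.+-identityʳ w))
             (cong (_*ᶻ H w) (ℤ.*-identityʳ (-1ℤ ^ᶻ p))))
      (trans (cong₂ (λ x c → x *ᶻ + c *ᶻ H (w + p * s)) (-1^[n+n]≡1 p) (nCn≡1 p))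
             (ℤ.*-identityˡ (H (w + p * s))))
    rearrange : ∀ h h′ → -1ℤ *ᶻ h +ᶻ h′ ≡ h′ -ᶻ h
    rearrange = solve-∀

  Δ^[p*m]≈Δ[p*s]^m : ∀ m s H w → Δ^ s (p * m) H w ≈ Δ^ (p * s) m H w
  Δ^[p*m]≈Δ[p*s]^m zero    s H w rewrite ℕ.*-zeroʳ p = ≈-refl
  Δ^[p*m]≈Δ[p*s]^m (suc m) s H w rewrite ℕ.*-suc p m = begin
    Δ^ s (p + p * m) H w              ≡⟨ Δ^-+ s p (p * m) H w ⟩
    Δ^ s p (Δ^ s (p * m) H) w         ≈⟨ Δ^p≈Δ[p*s] s (Δ^ s (p * m) H) w ⟩
    Δ (p * s) (Δ^ s (p * m) H) w      ≈⟨ Δ^-cong (p * s) 1 (Δ^[p*m]≈Δ[p*s]^m m s H) w ⟩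
    Δ (p * s) (Δ^ (p * s) m H) w      ∎

  Δ^[p^e*m]≈Δ[p^e]^m : ∀ e m H w → Δ^ 1 (p ^ e * m) H w ≈ Δ^ (p ^ e) m H w
  Δ^[p^e*m]≈Δ[p^e]^m zero    m H w rewrite ℕ.*-identityˡ m = ≈-refl
  Δ^[p^e*m]≈Δ[p^e]^m (suc e) m H w = begin
    Δ^ 1 (p * p ^ e * m) H w     ≡⟨ cong (λ r → Δ^ 1 r H w) (reassoc p (p ^ e) m) ⟩
    Δ^ 1 (p ^ e * (p * m)) H w   ≈⟨ Δ^[p^e*m]≈Δ[p^e]^m e (p * m) H w ⟩
    Δ^ (p ^ e) (p * m) H w       ≈⟨ Δ^[p*m]≈Δ[p*s]^m m (p ^ e) H w ⟩
    Δ^ (p * p ^ e) m H w         ∎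
    where
    reassoc : ∀ a b c → a * b * c ≡ b * (a * c)
    reassoc = ℕ-solve-∀


∂ : ∀ t {r} → (Point (t + r) → ℤ) → Point r → ℤ
∂ zero    g z = g z
∂ (suc t) g z = ∂ t (g ∘ (true ∷_)) z -ᶻ ∂ t (g ∘ (false ∷_)) z

∂-cong : ∀ t {r} {g h : Point (t + r) → ℤ} → (∀ x → g x ≡ h x) → ∀ z → ∂ t g z ≡ ∂ t h z
∂-cong zero    g≡h z = g≡h z
∂-cong (suc t) g≡h z = cong₂ _-ᶻ_ (∂-cong t (g≡h ∘ (true ∷_)) z) (∂-cong t (g≡h ∘ (false ∷_)) z)

∂-distrib-- : ∀ t {r} (g h : Point (t + r) → ℤ) z → ∂ t (λ x → g x -ᶻ h x) z ≡ ∂ t g z -ᶻ ∂ t h z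
∂-distrib-- zero    g h z = refl
∂-distrib-- (suc t) g h z
  rewrite ∂-distrib-- t (g ∘ (true ∷_)) (h ∘ (true ∷_)) z
        | ∂-distrib-- t (g ∘ (false ∷_)) (h ∘ (false ∷_)) z =
  regroup (∂ t (g ∘ (true ∷_)) z) (∂ t (h ∘ (true ∷_)) z)
          (∂ t (g ∘ (false ∷_)) z) (∂ t (h ∘ (false ∷_)) z)
  where
  regroup : ∀ a b c d → (a -ᶻ b) -ᶻ (c -ᶻ d) ≡ (a -ᶻ c) -ᶻ (b -ᶻ d)
  regroup = solve-∀

∂-weight : ∀ t {r} (G : ℕ → ℤ) (z : Point r) → ∂ t (G ∘ weight) z ≡ Δ^ 1 t G (weight z)
∂-weight zero    G z = refl
∂-weight (suc t) G z
  rewrite ∂-weight t (G ∘ suc) z | ∂-weight t G z | Δ^-suc 1 t G (weight z) | ℕ.+-comm (weight z) 1 = refl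

ones : ∀ t → Point t
ones zero    = []
ones (suc t) = true ∷ ones t

weight-ones-++ : ∀ t {r} (S : Point r) → weight (ones t ++ S) ≡ t + weight S
weight-ones-++ zero    S = refl
weight-ones-++ (suc t) S = cong suc (weight-ones-++ t S)

sum-allPoints-suc : ∀ {n} (h : Point (suc n) → ℕ) →
  sumL (map h (allPoints (suc n))) ≡
  sumL (map (h ∘ (false ∷_)) (allPoints n)) + sumL (map (h ∘ (true ∷_)) (allPoints n))
sum-allPoints-suc {n} h = begin
  sumL (map h (map (false ∷_) (allPoints n) L.++ map (true ∷_) (allPoints n)))
    ≡⟨ cong sumL (map-++ h (map (false ∷_) (allPoints n)) _) ⟩
  sumL (map h (map (false ∷_) (allPoints n)) L.++ map h (map (true ∷_) (allPoints n)))
    ≡⟨ sum-++ (map h (map (false ∷_) (allPoints n))) _ ⟩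
  sumL (map h (map (false ∷_) (allPoints n))) + sumL (map h (map (true ∷_) (allPoints n)))
    ≡⟨ sym (cong₂ (λ a b → sumL a + sumL b) (map-∘ (allPoints n)) (map-∘ (allPoints n))) ⟩
  sumL (map (h ∘ (false ∷_)) (allPoints n)) + sumL (map (h ∘ (true ∷_)) (allPoints n)) ∎
  where open ≡-Reasoning

sum-map-zero : ∀ {A : Set} {h : A → ℕ} → (∀ x → h x ≡ 0) → ∀ xs → sumL (map h xs) ≡ 0
sum-map-zero h≡0 L.[]       = refl
sum-map-zero h≡0 (x L.∷ xs) rewrite h≡0 x = sum-map-zero h≡0 xs

evalML-true∷ : ∀ {n} (c : Point (suc n) → ℕ) x →
  evalML c (true ∷ x) ≡ evalML (c ∘ (false ∷_)) x + evalML (c ∘ (true ∷_)) x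
evalML-true∷ c x = sum-allPoints-suc (λ S → c S * monomial S (true ∷ x))

evalML-false∷ : ∀ {n} (c : Point (suc n) → ℕ) x → evalML c (false ∷ x) ≡ evalML (c ∘ (false ∷_)) x
evalML-false∷ c x = begin
  evalML c (false ∷ x)
    ≡⟨ sum-allPoints-suc (λ S → c S * monomial S (false ∷ x)) ⟩
  evalML (c ∘ (false ∷_)) x + sumL (map (λ S → c (true ∷ S) * 0) (allPoints _))
    ≡⟨ cong (λ k → evalML (c ∘ (false ∷_)) x + k)
            (sum-map-zero (λ S → ℕ.*-zeroʳ (c (true ∷ S))) (allPoints _)) ⟩
  evalML (c ∘ (false ∷_)) x + 0
    ≡⟨ ℕ.+-identityʳ _ ⟩
  evalML (c ∘ (false ∷_)) x ∎
  where open ≡-Reasoning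

∂-evalML : ∀ t {r} (c : Point (t + r) → ℕ) z → ∂ t (+_ ∘ evalML c) z ≡ + evalML (c ∘ (ones t ++_)) z
∂-evalML zero    c z = refl
∂-evalML (suc t) c z = begin
  ∂ t (+_ ∘ evalML c ∘ (true ∷_)) z -ᶻ ∂ t (+_ ∘ evalML c ∘ (false ∷_)) z
    ≡⟨ sym (∂-distrib-- t (+_ ∘ evalML c ∘ (true ∷_)) (+_ ∘ evalML c ∘ (false ∷_)) z) ⟩
  ∂ t (λ y → + evalML c (true ∷ y) -ᶻ + evalML c (false ∷ y)) z
    ≡⟨ ∂-cong t difference z ⟩
  ∂ t (+_ ∘ evalML (c ∘ (true ∷_))) z
    ≡⟨ ∂-evalML t (c ∘ (true ∷_)) z ⟩
  + evalML (c ∘ (true ∷_) ∘ (ones t ++_)) z ∎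
  where
  open ≡-Reasoning
  difference : ∀ y → + evalML c (true ∷ y) -ᶻ + evalML c (false ∷ y) ≡ + evalML (c ∘ (true ∷_)) y
  difference y rewrite evalML-true∷ c y | evalML-false∷ c y
    | ℤ.pos-+ (evalML (c ∘ (false ∷_)) y) (evalML (c ∘ (true ∷_)) y) =
      cancel (+ evalML (c ∘ (false ∷_)) y) (+ evalML (c ∘ (true ∷_)) y)
    where
    cancel : ∀ a b → (a +ᶻ b) -ᶻ a ≡ b
    cancel = solve-∀

∣-sum-map : ∀ {m} {A : Set} {h : A → ℕ} → (∀ x → m ∣ℕ h x) → ∀ xs → m ∣ℕ sumL (map h xs)
∣-sum-map {m} m∣h L.[]       = m ℕ∣.∣0
∣-sum-map     m∣h (x L.∷ xs) = ℕ∣.∣m∣n⇒∣m+n (m∣h x) (∣-sum-map m∣h xs)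

module _ {p : ℕ} where
  open Congruence p

  ∂-cong≈ : ∀ t {r} {g h : Point (t + r) → ℤ} → (∀ x → g x ≈ h x) → ∀ z → ∂ t g z ≈ ∂ t h z
  ∂-cong≈ zero    g≈h z = g≈h z
  ∂-cong≈ (suc t) g≈h z =
    -‿cong₂ (∂-cong≈ t (g≈h ∘ (true ∷_)) z) (∂-cong≈ t (g≈h ∘ (false ∷_)) z)

  ∂-low-degree≈0 : ∀ t {r} (f : Fn (t + r)) d → DegLe p f d → d < t → ∀ z → ∂ t (+_ ∘ f) z ≈ 0ℤ
  ∂-low-degree≈0 t {r} f d (c , high≡0 , f≡evalML) d<t z = begin
    ∂ t (+_ ∘ f) z                            ≈⟨ ∂-cong≈ t (fromℕ ∘ f≡evalML) z ⟩
    ∂ t (+_ ∘ evalML c) z                     ≡⟨ ∂-evalML t c z ⟩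
    + evalML (c ∘ (ones t ++_)) z             ≈⟨ ∣ᵤ⇒≈0 (∣-sum-map p∣term (allPoints r)) ⟩
    0ℤ                                        ∎
    where
    open import Relation.Binary.Reasoning.Setoid ≈-setoid
    p∣term : ∀ S → p ∣ℕ c (ones t ++ S) * monomial S z
    p∣term S =
      ℕ∣.∣-trans (≈0⇒∣ᵤ (fromℕ (high≡0 (ones t ++ S) d<weight))) (ℕ∣.m∣m*n (monomial S z))
      where
      d<weight : d < weight (ones t ++ S)
      d<weight = subst (d <_) (sym (weight-ones-++ t S)) (ℕ.<-≤-trans d<t (ℕ.m≤m+n t (weight S)))

canonical : ∀ n → ℕ → Point n
canonical zero    w       = []
canonical (suc n) zero    = false ∷ canonical n zero
canonical (suc n) (suc w) = true ∷ canonical n w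

weight-canonical : ∀ {n w} → w ≤ n → weight (canonical n w) ≡ w
weight-canonical {zero}  {zero}  _         = refl
weight-canonical {suc n} {zero}  _         = weight-canonical {n} z≤n
weight-canonical {suc n} {suc w} (s≤s w≤n) = cong suc (weight-canonical w≤n)

weight≤length : ∀ {n} (x : Point n) → weight x ≤ n
weight≤length []          = z≤n
weight≤length (false ∷ x) = ℕ.m≤n⇒m≤1+n (weight≤length x)
weight≤length (true ∷ x)  = s≤s (weight≤length x)

module _ {p : ℕ} where
  open Congruence p

  symmetric-∷ : ∀ {n} (f : Fn (suc n)) b → Symmetric p f → Symmetric p (f ∘ (b ∷_))
  symmetric-∷ f b f-sym σ x = f-sym (lift₀ σ) (b ∷ x)

  symmetric-swap : ∀ {n} (f : Fn (suc (suc n))) → Symmetric p f →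
                   ∀ a b u → + f (a ∷ b ∷ u) ≈ + f (b ∷ a ∷ u)
  symmetric-swap f f-sym a b u =
    ≈-sym (subst (λ y → + f y ≈ + f (a ∷ b ∷ u)) (cong (λ z → b ∷ a ∷ z) (tabulate∘lookup u))
      (fromℕ (f-sym (transpose zero (suc zero)) (a ∷ b ∷ u))))

  false∷canonical≈canonical : ∀ {n} (f : Fn (suc n)) → Symmetric p f → ∀ {w} → w ≤ n →
    + f (false ∷ canonical n w) ≈ + f (canonical (suc n) w)
  false∷canonical≈canonical f f-sym {zero}  _ = ≈-refl
  false∷canonical≈canonical f f-sym {suc w} (s≤s w≤n) =
    ≈-trans (symmetric-swap f f-sym false true _)
            (false∷canonical≈canonical (f ∘ (true ∷_)) (symmetric-∷ f true f-sym) w≤n)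

  symmetric≈canonical : ∀ {n} (f : Fn n) → Symmetric p f → ∀ x → + f x ≈ + f (canonical n (weight x))
  symmetric≈canonical f f-sym []          = ≈-refl
  symmetric≈canonical f f-sym (true ∷ x)  =
    symmetric≈canonical (f ∘ (true ∷_)) (symmetric-∷ f true f-sym) x
  symmetric≈canonical f f-sym (false ∷ x) =
    ≈-trans (symmetric≈canonical (f ∘ (false ∷_)) (symmetric-∷ f false f-sym) x)
            (false∷canonical≈canonical f f-sym (weight≤length x))

coprime-^ʳ : ∀ {q p} e → Coprime q p → Coprime q (p ^ e)
coprime-^ʳ zero    _         (_   , d∣1)    = ℕ∣.∣1⇒≡1 d∣1
coprime-^ʳ (suc e) coprime-qp (d∣q , d∣p*p^e) =
  coprime-^ʳ e coprime-qp (d∣q , coprime-divisor coprime-dp d∣p*p^e)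
  where
  coprime-dp : Coprime _ _
  coprime-dp (k∣d , k∣p) = coprime-qp (ℕ∣.∣-trans k∣d d∣q , k∣p)

private
  no-two-multiples : ∀ {q s M j a b} → Coprime q s → M < q → a < b → b ≤ M →
    q ∣ℕ j + a * s → q ∣ℕ j + b * s → ⊥
  no-two-multiples {q} {s} {M} {j} {a} {b} coprime-qs M<q a<b b≤M q∣a q∣b =
    ℕ.<-irrefl refl (ℕ.<-≤-trans M<q (ℕ.≤-trans (ℕ∣.∣⇒≤ {{>-nonZero (ℕ.m<n⇒0<n∸m a<b)}} q∣b-a)
                                                (ℕ.≤-trans (ℕ.m∸n≤m b a) b≤M)))
    where
    j+b*s≡j+a*s+[b∸a]*s : j + b * s ≡ (j + a * s) + (b ∸ a) * s
    j+b*s≡j+a*s+[b∸a]*s =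
      trans (cong (λ x → j + x * s) (sym (ℕ.m+[n∸m]≡n (ℕ.<⇒≤ a<b)))) (distrib j a (b ∸ a) s)
      where
      distrib : ∀ j a d s → j + (a + d) * s ≡ (j + a * s) + d * s
      distrib = ℕ-solve-∀
    q∣b-a : q ∣ℕ b ∸ a
    q∣b-a = coprime-divisor coprime-qs (subst (q ∣ℕ_) (ℕ.*-comm (b ∸ a) s)
              (ℕ∣.∣m+n∣m⇒∣n (subst (q ∣ℕ_) j+b*s≡j+a*s+[b∸a]*s q∣b) q∣a))

multiple-in-progression-unique : ∀ {q s M j a i} → Coprime q s → M < q → a ≤ M → i ≤ M →
  q ∣ℕ j + a * s → q ∣ℕ j + i * s → i ≡ a
multiple-in-progression-unique {a = a} {i} coprime-qs M<q a≤M i≤M q∣a q∣i with ℕ.<-cmp i a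
... | tri< i<a _ _ = ⊥-elim (no-two-multiples coprime-qs M<q i<a a≤M q∣i q∣a)
... | tri≈ _ i≡a _ = i≡a
... | tri> _ _ a<i = ⊥-elim (no-two-multiples coprime-qs M<q a<i i≤M q∣a q∣i)

progression-through : ∀ s M {n w} .{{_ : NonZero s}} → s * suc M ≤ n + 1 → w ≤ n →
  Σ ℕ λ j → Σ ℕ λ a → j + a * s ≡ w × a ≤ M × j + s * M ≤ n
progression-through s M {n} {w} s[1+M]≤n+1 w≤n with s * M ℕ.≤? w
... | yes sM≤w =
  w ∸ s * M , M , trans (cong (λ x → w ∸ s * M + x) (ℕ.*-comm M s)) (ℕ.m∸n+n≡m sM≤w) ,
  ℕ.≤-refl , subst (_≤ n) (sym (ℕ.m∸n+n≡m sM≤w)) w≤n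
... | no sM≰w = w % s , w / s , sym (m≡m%n+[m/n]*n w s) , ℕ.<⇒≤ w/s<M , w%s+sM≤n
  where
  w/s<M : w / s < M
  w/s<M = ℕ.*-cancelʳ-< s (w / s) M
            (ℕ.≤-<-trans (m/n*n≤m w s) (subst (w <_) (ℕ.*-comm s M) (ℕ.≰⇒> sM≰w)))
  w%s+sM≤n : w % s + s * M ≤ n
  w%s+sM≤n = ℕ.≤-pred (subst (suc (w % s + s * M) ≤_) (ℕ.+-comm n 1)
               (ℕ.≤-trans (ℕ.+-monoˡ-< (s * M) (m%n<n w s)) (subst (_≤ n + 1) (ℕ.*-suc s M) s[1+M]≤n+1)))

module _ {p : ℕ} (prime-p : Prime p) where
  open Congruence p
  open import Relation.Binary.Reasoning.Setoid ≈-setoid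

  ±c*x≈0⇒x≈0 : ∀ n c x → ¬ p ∣ℕ c → -1ℤ ^ᶻ n *ᶻ + c *ᶻ x ≈ 0ℤ → x ≈ 0ℤ
  ±c*x≈0⇒x≈0 n c x p∤c ±c*x≈0 =
    [ flip contradiction p∤c , ∣ᵤ⇒≈0 ]′ (euclidsLemma c ℤ.∣ x ∣ prime-p p∣c*∣x∣)
    where
    σ : ℤ
    σ = -1ℤ ^ᶻ n
    σ*σ≡1 : σ *ᶻ σ ≡ 1ℤ
    σ*σ≡1 = trans (sym (ℤ.^-distribˡ-+-* -1ℤ n n)) (-1^[n+n]≡1 n)
    c*x≈0 : + c *ᶻ x ≈ 0ℤ
    c*x≈0 = begin
      + c *ᶻ x                    ≡⟨ sym (ℤ.*-identityˡ (+ c *ᶻ x)) ⟩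
      1ℤ *ᶻ (+ c *ᶻ x)            ≡⟨ cong (_*ᶻ (+ c *ᶻ x)) (sym σ*σ≡1) ⟩
      σ *ᶻ σ *ᶻ (+ c *ᶻ x)        ≡⟨ reassoc σ (+ c) x ⟩
      σ *ᶻ (σ *ᶻ + c *ᶻ x)        ≈⟨ ≈0-*ˡ σ ±c*x≈0 ⟩
      0ℤ                          ∎
      where
      reassoc : ∀ s c x → s *ᶻ s *ᶻ (c *ᶻ x) ≡ s *ᶻ (s *ᶻ c *ᶻ x)
      reassoc = solve-∀
    p∣c*∣x∣ : p ∣ℕ c * ℤ.∣ x ∣
    p∣c*∣x∣ = subst (p ∣ℕ_) (ℤ.abs-* (+ c) x) (≈0⇒∣ᵤ c*x≈0)

  Δ^-low-degree≈0 : ∀ {n} t (f : Fn n) → Symmetric p f → ∀ d → DegLe p f d → d < t →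
    ∀ {j} → j + t ≤ n → Δ^ 1 t (λ w → + f (canonical n w)) j ≈ 0ℤ
  Δ^-low-degree≈0 {n} t f f-sym d deg-f d<t {j} j+t≤n =
    split t (n ∸ t) (ℕ.m+[n∸m]≡n t≤n) f f-sym deg-f d<t (ℕ.m+n≤o⇒m≤o∸n j j+t≤n)
    where
    t≤n : t ≤ n
    t≤n = ℕ.≤-trans (ℕ.m≤n+m t j) j+t≤n
    split : ∀ t r → t + r ≡ n → (f : Fn n) → Symmetric p f → DegLe p f d → d < t → j ≤ r →
      Δ^ 1 t (λ w → + f (canonical n w)) j ≈ 0ℤ
    split t r refl f f-sym deg-f d<t j≤r = begin
      Δ^ 1 t F j              ≡⟨ cong (Δ^ 1 t F) (sym (weight-canonical j≤r)) ⟩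
      Δ^ 1 t F (weight z)     ≡⟨ sym (∂-weight t F z) ⟩
      ∂ t (F ∘ weight) z      ≈⟨ ∂-cong≈ t (λ x → ≈-sym (symmetric≈canonical f f-sym x)) z ⟩
      ∂ t (+_ ∘ f) z          ≈⟨ ∂-low-degree≈0 t f d deg-f d<t z ⟩
      0ℤ                      ∎
      where
      F : ℕ → ℤ
      F w = + f (canonical (t + r) w)
      z : Point r
      z = canonical r j

  inIdealChi⇒≈0 : ∀ {q n} (f : Fn n) → InIdealChi p q f → ∀ x → ¬ q ∣ℕ weight x → + f x ≈ 0ℤ
  inIdealChi⇒≈0 {q} f (g , f≡g*χ) x q∤|x| with q ℕ∣.∣? weight x | f≡g*χ x
  ... | yes q∣|x| | _     = contradiction q∣|x| q∤|x|
  ... | no _      | f≡g*0 = ≈-trans (fromℕ f≡g*0) (≈-reflexive (cong +_ (ℕ.*-zeroʳ (g x))))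

  Δ^-isolated≈0 : ∀ e c (F : ℕ → ℤ) j {a} → a ≤ p ^ c ∸ 1 →
    (∀ i → i ≤ p ^ c ∸ 1 → i ≢ a → F (j + i * p ^ e) ≈ 0ℤ) →
    Δ^ 1 (p ^ e * (p ^ c ∸ 1)) F j ≈ 0ℤ → F (j + a * p ^ e) ≈ 0ℤ
  Δ^-isolated≈0 e c F j {a} a≤M others≈0 Δ^F≈0 =
    ±c*x≈0⇒x≈0 (M + a) (M C a) (F (j + a * s)) (p∤[p^c∸1]Ck prime-p c a a<p^c) (begin
      signedBinomial M a *ᶻ F (j + a * s)   ≈⟨ ≈-sym (∑<-single g (s≤s a≤M) other-terms≈0) ⟩
      ∑< (suc M) g                          ≡⟨ sym (Δ^-expansion s M F j) ⟩
      Δ^ s M F j                            ≈⟨ ≈-sym (Δ^[p^e*m]≈Δ[p^e]^m prime-p e M F j) ⟩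
      Δ^ 1 (s * M) F j                      ≈⟨ Δ^F≈0 ⟩
      0ℤ                                    ∎)
    where
    s M : ℕ
    s = p ^ e
    M = p ^ c ∸ 1
    g : ℕ → ℤ
    g i = signedBinomial M i *ᶻ F (j + i * s)
    other-terms≈0 : ∀ i → i < suc M → i ≢ a → g i ≈ 0ℤ
    other-terms≈0 i (s≤s i≤M) i≢a = ≈0-*ˡ (signedBinomial M i) (others≈0 i i≤M i≢a)
    a<p^c : a < p ^ c
    a<p^c = subst (a <_) (suc[p^c∸1]≡p^c prime-p c) (s≤s a≤M)

  lower-bound : ∀ {q n} c e → Coprime q p → p ^ c ≤ q → p ^ e * p ^ c ≤ n + 1 →
    (f : Fn n) → InIdealChi p q f → NonZeroFn p f → Symmetric p f →
    ∀ d → DegLe p f d → p ^ e * (p ^ c ∸ 1) ≤ d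
  lower-bound {q} {n} c e coprime-qp p^c≤q p^e*p^c≤n+1 f f∈⟨χ⟩ (x₀ , f[x₀]≢0) f-sym d deg-f =
    ℕ.≮⇒≥ λ d<s*M → f[x₀]≢0 (toℕ (≈-trans (symmetric≈canonical f f-sym x₀) (F[w₀]≈0 d<s*M)))
    where
    s M w₀ : ℕ
    s = p ^ e
    M = p ^ c ∸ 1
    w₀ = weight x₀
    F : ℕ → ℤ
    F w = + f (canonical n w)
    q∣w₀ : q ∣ℕ w₀
    q∣w₀ = decidable-stable (q ℕ∣.∣? w₀)
             (λ q∤w₀ → f[x₀]≢0 (toℕ (inIdealChi⇒≈0 f f∈⟨χ⟩ x₀ q∤w₀)))
    s[1+M]≤n+1 : s * suc M ≤ n + 1
    s[1+M]≤n+1 = subst (λ k → s * k ≤ n + 1) (sym (suc[p^c∸1]≡p^c prime-p c)) p^e*p^c≤n+1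
    F[w₀]≈0 : d < s * M → F w₀ ≈ 0ℤ
    F[w₀]≈0 d<s*M
      with progression-through s M {{ℕ.m^n≢0 p e {{prime⇒nonZero prime-p}}}} s[1+M]≤n+1 (weight≤length x₀)
    ... | j , a , j+a*s≡w₀ , a≤M , j+s*M≤n = subst (λ w → F w ≈ 0ℤ) j+a*s≡w₀
      (Δ^-isolated≈0 e c F j a≤M others≈0 (Δ^-low-degree≈0 (s * M) f f-sym d deg-f d<s*M j+s*M≤n))
      where
      others≈0 : ∀ i → i ≤ M → i ≢ a → F (j + i * s) ≈ 0ℤ
      others≈0 i i≤M i≢a = inIdealChi⇒≈0 f f∈⟨χ⟩ (canonical n (j + i * s)) q∤weight
        where
        j+i*s≤n : j + i * s ≤ n
        j+i*s≤n =
          ℕ.≤-trans (ℕ.+-monoʳ-≤ j (subst (i * s ≤_) (ℕ.*-comm M s) (ℕ.*-monoˡ-≤ s i≤M))) j+s*M≤n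
        M<q : M < q
        M<q = subst (_≤ q) (sym (suc[p^c∸1]≡p^c prime-p c)) p^c≤q
        q∤weight : ¬ q ∣ℕ weight (canonical n (j + i * s))
        q∤weight rewrite weight-canonical j+i*s≤n = i≢a ∘
          multiple-in-progression-unique (coprime-^ʳ e coprime-qp) M<q a≤M i≤M
            (subst (q ∣ℕ_) (sym j+a*s≡w₀) q∣w₀)

n∸[n+1∸A]≡A∸1 : ∀ n A → A ≤ n + 1 → n ∸ (n + 1 ∸ A) ≡ A ∸ 1
n∸[n+1∸A]≡A∸1 n zero    _ = ℕ.m≤n⇒m∸n≡0 (ℕ.m≤m+n n 1)
n∸[n+1∸A]≡A∸1 n (suc A) A+1≤n+1 rewrite ℕ.+-comm n 1 = ℕ.m∸[m∸n]≡n (ℕ.≤-pred A+1≤n+1)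

[a*b∸1]*[b∸1]≤d*b : ∀ a b d → a * (b ∸ 1) ≤ d → (a * b ∸ 1) * (b ∸ 1) ≤ d * b
[a*b∸1]*[b∸1]≤d*b a b d a[b∸1]≤d = begin
  (a * b ∸ 1) * (b ∸ 1)   ≤⟨ ℕ.*-monoˡ-≤ (b ∸ 1) (ℕ.m∸n≤m (a * b) 1) ⟩
  a * b * (b ∸ 1)         ≡⟨ swap a b (b ∸ 1) ⟩
  a * (b ∸ 1) * b         ≤⟨ ℕ.*-monoˡ-≤ b a[b∸1]≤d ⟩
  d * b                   ∎
  where
  open ℕ.≤-Reasoning
  swap : ∀ a b c → a * b * c ≡ a * c * b
  swap = ℕ-solve-∀

[a∸1]*[b∸1]≤d*b : ∀ a b d → a ∸ 1 ≤ d → (a ∸ 1) * (b ∸ 1) ≤ d * b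
[a∸1]*[b∸1]≤d*b a b d a∸1≤d = ℕ.*-mono-≤ a∸1≤d (ℕ.m∸n≤m b 1)

mainTheorem11 : (p q n : ℕ) → Prime p → 2 ≤ q → Coprime q p → 1 < n →
    (k : ℕ) → p ^ k ≤ n + 1 → n + 1 < p ^ suc k →
    (ℓ : ℕ) → p ^ ℓ ≤ q ∸ 1 → q ∸ 1 < p ^ suc ℓ →
    (f : Fn n) → InIdealChi p q f → NonZeroFn p f → Symmetric p f →
    (d : ℕ) → DegLe p f d →
    (n ∸ (n + 1 ∸ p ^ k)) * (p ^ ℓ ∸ 1) ≤ d * p ^ ℓ
mainTheorem11 p q n prime-p _ coprime-qp _ k p^k≤n+1 _ ℓ p^ℓ≤q∸1 _ f f∈⟨χ⟩ f≢0 f-sym d deg-f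
  rewrite n∸[n+1∸A]≡A∸1 n (p ^ k) p^k≤n+1 = case ℓ ℕ.≤? k of λ where
    (yes ℓ≤k) → subst (λ A → (A ∸ 1) * (p ^ ℓ ∸ 1) ≤ d * p ^ ℓ) (p^[k∸ℓ]*p^ℓ≡p^k ℓ≤k)
      ([a*b∸1]*[b∸1]≤d*b (p ^ (k ∸ ℓ)) (p ^ ℓ) d
        (bound ℓ (k ∸ ℓ) p^ℓ≤q (subst (_≤ n + 1) (sym (p^[k∸ℓ]*p^ℓ≡p^k ℓ≤k)) p^k≤n+1)))
    (no ℓ≰k) → [a∸1]*[b∸1]≤d*b (p ^ k) (p ^ ℓ) d
      (subst (_≤ d) (ℕ.*-identityˡ (p ^ k ∸ 1))
        (bound k 0 (ℕ.≤-trans (ℕ.^-monoʳ-≤ p (ℕ.<⇒≤ (ℕ.≰⇒> ℓ≰k))) p^ℓ≤q)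
          (subst (_≤ n + 1) (sym (ℕ.*-identityˡ (p ^ k))) p^k≤n+1)))
  where
  instance
    p≢0 : NonZero p
    p≢0 = prime⇒nonZero prime-p
  p^ℓ≤q : p ^ ℓ ≤ q
  p^ℓ≤q = ℕ.≤-trans p^ℓ≤q∸1 (ℕ.m∸n≤m q 1)
  p^[k∸ℓ]*p^ℓ≡p^k : ℓ ≤ k → p ^ (k ∸ ℓ) * p ^ ℓ ≡ p ^ k
  p^[k∸ℓ]*p^ℓ≡p^k ℓ≤k =
    trans (sym (ℕ.^-distribˡ-+-* p (k ∸ ℓ) ℓ)) (cong (p ^_) (ℕ.m∸n+n≡m ℓ≤k))
  bound : ∀ c e → p ^ c ≤ q → p ^ e * p ^ c ≤ n + 1 → p ^ e * (p ^ c ∸ 1) ≤ d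
  bound c e p^c≤q p^e*p^c≤n+1 =
    lower-bound prime-p c e coprime-qp p^c≤q p^e*p^c≤n+1 f f∈⟨χ⟩ f≢0 f-sym d deg-f
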